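{- Let $b\ge2$ be an integer. (1) For any nonempty subset $S$ of $\mathbb{Z}$, the sequence $(\alpha_k(S,b))_{k\ge0}$ is weakly increasing: $\alpha_{k+1}(S,b)\ge\alpha_k(S,b)$ for all $k\ge0$. (2) For any nonempty subset $S$ of $\mathbb{Z}$ and any nonnegative integers $k,\ell$: $\alpha_{k+\ell}(S,b)\ge\alpha_k(S,b)+\alpha_\ell(S,b)$. (3) If $S_1\subseteq S_2\subseteq\mathbb{Z}$ are nonempty, then $\alpha_k(S_1,b)\ge\alpha_k(S_2,b)$ for every $k\ge0$.
   Context: For $a\in\mathbb{Z}$, $\operatorname{ord}_b(a):=\sup\{k\in\mathbb{N}: b^k\mid a\}$ ($\operatorname{ord}_b(0)=+\infty$). A $b$-ordering of nonempty $S\subseteq\mathbb{Z}$ is an infinite sequence $(a_i)_{i\ge0}$ in $S$ such that for each $i\ge1$, $\sum_{j<i}\operatorname{ord}_b(a_i-a_j)=\min_{a'\in S}\sum_{j<i}\operatorname{ord}_b(a'-a_j)$. The value $\alpha_k(S,b):=\sum_{j<k}\operatorname{ord}_b(a_k-a_j)\in\mathbb{N}\cup\{+\infty\}$ (with $\alpha_0=0$) does not depend on the choice of $b$-ordering. -}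

module Defs where

open import Data.Nat as ℕ using (ℕ; zero; suc; _^_)
open import Data.Nat.Divisibility using (_∣?_)
open import Data.Integer as ℤ using (ℤ; ∣_∣; _-_)
open import Relation.Nullary using (yes; no)
open import Relation.Nullary.Decidable using (does)
open import Data.Bool using (if_then_else_)
open import Relation.Unary using (Pred)
open import Level using (0ℓ)

data ℕ∞ : Set where
  fin : ℕ → ℕ∞
  ∞   : ℕ∞

infixl 6 _+∞_
_+∞_ : ℕ∞ → ℕ∞ → ℕ∞
fin m +∞ fin n = fin (m ℕ.+ n)
fin _ +∞ ∞     = ∞
∞     +∞ _     = ∞

infix 4 _≤∞_
data _≤∞_ : ℕ∞ → ℕ∞ → Set where
  fin≤fin : ∀ {m n} → m ℕ.≤ n → fin m ≤∞ fin n
  _≤∞∞    : ∀ x → x ≤∞ ∞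

maxPowDiv : ℕ → ℕ → ℕ → ℕ
maxPowDiv b n zero    = zero
maxPowDiv b n (suc k) = if does (b ^ suc k ∣? n) then suc k else maxPowDiv b n k

-- ord_b(a) = sup { k : b^k ∣ a }, with ord_b(0) = ∞.
-- For a ≠ 0 and b ≥ 2, b^k ∣ a forces k ≤ |a|, so the sup equals the
-- largest k ≤ |a| with b^k ∣ |a|.
ord : ℕ → ℤ → ℕ∞
ord b a with ∣ a ∣
... | zero  = ∞
... | suc m = fin (maxPowDiv b (suc m) (suc m))

sumOrd : ℕ → (ℕ → ℤ) → ℕ → ℤ → ℕ∞
sumOrd b a zero    x = fin 0
sumOrd b a (suc i) x = sumOrd b a i x +∞ ord b (x - a i)

record IsBOrdering (b : ℕ) (S : Pred ℤ 0ℓ) (a : ℕ → ℤ) : Set where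
  field
    inS     : ∀ i → S (a i)
    minimal : ∀ i → 1 ℕ.≤ i → ∀ a′ → S a′ → sumOrd b a i (a i) ≤∞ sumOrd b a i a′

-- α_k(S,b) computed from a b-ordering a of S (independent of the choice)
α : ℕ → (ℕ → ℤ) → ℕ → ℕ∞
α b a k = sumOrd b a k (a k)

{-# OPTIONS --safe #-}
-- ord_b is an ultrametric valuation on differences. For a b-ordering (a_i) and
-- m ≤ K, scanning the a_j with m < j ≤ K from the top down and using the ultrametric
-- inequality shows Σ_{i ≤ K, i ≠ m} ord_b (a_m - a_i) ≤ α_K. Given any K integers
-- x_1 … x_K, matching each x greedily with the closest of a_0 … a_K leaves one a_m
-- with Σ_j ord_b (a_m - x_j) bounded by that sum, hence by α_K. Taking the x's to be
-- a_0 … a_{k-1}, a_0 … a_{l-1} gives α_k + α_l ≤ α_{k+l} by minimality of α_k and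
-- α_l; taking them to be the first k terms of a b-ordering of S₂ ⊇ S₁ gives
-- α_k(S₂) ≤ α_k(S₁). Monotonicity is minimality of α_k tested at a_{k+1}.
module Submission where

open import Defs
open import Data.Nat using (ℕ; suc; _+_; _≤_)
open import Data.Integer using (ℤ)
open import Data.Product using (_×_; ∃)
open import Relation.Unary using (Pred; _⊆_)
open import Level using (0ℓ)

open import Data.Nat as ℕ using (zero; z≤n; s≤s; _<_; _^_; _∸_)
import Data.Nat.Properties as ℕ
open import Data.Nat.Divisibility as ℕ using (_∣?_)
open import Data.Nat.Induction using (<-rec)
open import Data.Integer as ℤ using (+_; ∣_∣; _-_)
import Data.Integer.Properties as ℤ
open import Data.Integer.Divisibility.Signed as ℤ using (∣ᵤ⇒∣; ∣⇒∣ᵤ; ∣m∣n⇒∣m+n)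
open import Data.List using (List; []; _∷_; _++_; length; applyDownFrom)
open import Data.List.Properties using (length-++; length-applyDownFrom)
open import Data.List.Membership.Propositional.Properties using (∈-applyDownFrom⁻)
open import Data.List.Relation.Binary.Permutation.Propositional
  using (_↭_; refl; prep; swap; trans; ↭-refl; ↭-trans; ↭-prep; ↭-swap; ↭-reflexive)
open import Data.List.Relation.Binary.Permutation.Propositional.Properties
  using (∈-resp-↭; ↭-length; All-resp-↭; shift; drop-∷)
open import Data.List.Relation.Unary.All as All using (All; []; _∷_)
open import Data.List.Relation.Unary.Any using (here)
open import Data.Product using (_,_; ∃₂)
open import Data.Sum using (_⊎_; inj₁; inj₂)
open import Data.Empty using (⊥-elim)
open import Function using (_∘_)
open import Relation.Binary.Bundles using (Preorder)
open import Relation.Binary.Structures using (IsPreorder)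
import Relation.Binary.Reasoning.Preorder as PreorderReasoning
open import Relation.Binary.PropositionalEquality as ≡
  using (_≡_; refl; sym; cong; cong₂; subst; isEquivalence; module ≡-Reasoning)
open import Relation.Nullary using (yes; no)

+∞-identityʳ : ∀ x → x +∞ fin 0 ≡ x
+∞-identityʳ (fin m) = cong fin (ℕ.+-identityʳ m)
+∞-identityʳ ∞       = refl

+∞-zeroʳ : ∀ x → x +∞ ∞ ≡ ∞
+∞-zeroʳ (fin _) = refl
+∞-zeroʳ ∞       = refl

+∞-assoc : ∀ x y z → (x +∞ y) +∞ z ≡ x +∞ (y +∞ z)
+∞-assoc (fin l) (fin m) (fin n) = cong fin (ℕ.+-assoc l m n)
+∞-assoc (fin _) (fin _) ∞       = refl
+∞-assoc (fin _) ∞       _       = refl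
+∞-assoc ∞       _       _       = refl

+∞-comm : ∀ x y → x +∞ y ≡ y +∞ x
+∞-comm (fin m) (fin n) = cong fin (ℕ.+-comm m n)
+∞-comm (fin _) ∞       = refl
+∞-comm ∞       (fin _) = refl
+∞-comm ∞       ∞       = refl

xy+z≡xz+y : ∀ x y z → (x +∞ y) +∞ z ≡ (x +∞ z) +∞ y
xy+z≡xz+y x y z = begin
  (x +∞ y) +∞ z ≡⟨ +∞-assoc x y z ⟩
  x +∞ (y +∞ z) ≡⟨ cong (x +∞_) (+∞-comm y z) ⟩
  x +∞ (z +∞ y) ≡⟨ +∞-assoc x z y ⟨
  (x +∞ z) +∞ y ∎
  where open ≡-Reasoning

≤∞-refl : ∀ {x} → x ≤∞ x
≤∞-refl {fin _} = fin≤fin ℕ.≤-refl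
≤∞-refl {∞}     = ∞ ≤∞∞

≤∞-trans : ∀ {x y z} → x ≤∞ y → y ≤∞ z → x ≤∞ z
≤∞-trans (fin≤fin p) (fin≤fin q) = fin≤fin (ℕ.≤-trans p q)
≤∞-trans {x} _       (_ ≤∞∞)     = x ≤∞∞

≤∞-total : ∀ x y → x ≤∞ y ⊎ y ≤∞ x
≤∞-total (fin m) (fin n) with ℕ.≤-total m n
... | inj₁ m≤n = inj₁ (fin≤fin m≤n)
... | inj₂ n≤m = inj₂ (fin≤fin n≤m)
≤∞-total x       ∞       = inj₁ (x ≤∞∞)
≤∞-total ∞       (fin n) = inj₂ (fin n ≤∞∞)

≤∞-isPreorder : IsPreorder _≡_ _≤∞_
≤∞-isPreorder = record
  { isEquivalence = isEquivalence
  ; reflexive     = λ { refl → ≤∞-refl }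
  ; trans         = ≤∞-trans
  }

≤∞-preorder : Preorder 0ℓ 0ℓ 0ℓ
≤∞-preorder = record { isPreorder = ≤∞-isPreorder }

module ≤∞-Reasoning = PreorderReasoning ≤∞-preorder

+∞-mono-≤∞ : ∀ {x x′ y y′} → x ≤∞ x′ → y ≤∞ y′ → x +∞ y ≤∞ x′ +∞ y′
+∞-mono-≤∞ (fin≤fin m≤m′) (fin≤fin n≤n′) = fin≤fin (ℕ.+-mono-≤ m≤m′ n≤n′)
+∞-mono-≤∞ {x} {x′} {y} _ (_ ≤∞∞) = subst (x +∞ y ≤∞_) (sym (+∞-zeroʳ x′)) ((x +∞ y) ≤∞∞)
+∞-mono-≤∞ {x} {y = y} (_ ≤∞∞) (fin≤fin _) = (x +∞ y) ≤∞∞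

x≤∞x+∞y : ∀ x y → x ≤∞ x +∞ y
x≤∞x+∞y (fin m) (fin n) = fin≤fin (ℕ.m≤m+n m n)
x≤∞x+∞y (fin m) ∞       = fin m ≤∞∞
x≤∞x+∞y ∞       y       = ∞ ≤∞∞

fin-bounds⇒≤∞ : ∀ {x y} → (∀ e → fin e ≤∞ x → fin e ≤∞ y) → x ≤∞ y
fin-bounds⇒≤∞ {fin m} bounds = bounds m ≤∞-refl
fin-bounds⇒≤∞ {∞} {∞}     _  = ∞ ≤∞∞
fin-bounds⇒≤∞ {∞} {fin n} bounds with bounds (suc n) (fin (suc n) ≤∞∞)
... | fin≤fin 1+n≤n = ⊥-elim (ℕ.1+n≰n 1+n≤n)

n<b^n : ∀ {b} → 2 ≤ b → ∀ n → n < b ^ n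
n<b^n (s≤s (s≤s _)) zero = s≤s z≤n
n<b^n {b} 2≤b@(s≤s (s≤s _)) (suc n) = begin-strict
  suc n          <⟨ s≤s (n<b^n 2≤b n) ⟩
  suc (b ^ n)    ≤⟨ ℕ.+-monoˡ-≤ (b ^ n) (ℕ.m^n>0 b n) ⟩
  b ^ n + b ^ n  ≡⟨ cong (λ t → b ^ n + t) (ℕ.+-identityʳ (b ^ n)) ⟨
  2 ℕ.* b ^ n    ≤⟨ ℕ.*-monoˡ-≤ (b ^ n) 2≤b ⟩
  b ℕ.* b ^ n    ∎
  where open ℕ.≤-Reasoning

^-monoʳ-∣ : ∀ b {e r} → e ≤ r → b ^ e ℕ.∣ b ^ r
^-monoʳ-∣ b {e} {r} e≤r = subst (b ^ e ℕ.∣_) b^e*b^[r∸e]≡b^r (ℕ.m∣m*n (b ^ (r ∸ e)))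
  where
  b^e*b^[r∸e]≡b^r : b ^ e ℕ.* b ^ (r ∸ e) ≡ b ^ r
  b^e*b^[r∸e]≡b^r = ≡.trans (sym (ℕ.^-distribˡ-+-* b e (r ∸ e))) (cong (b ^_) (ℕ.m+[n∸m]≡n e≤r))

applyDownFrom-split : ∀ {A : Set} (f : ℕ → A) m n →
  applyDownFrom f (suc (n + m)) ≡ applyDownFrom (λ j → f (suc (j + m))) n ++ f m ∷ applyDownFrom f m
applyDownFrom-split f m zero    = refl
applyDownFrom-split f m (suc n) = cong (f (suc (n + m)) ∷_) (applyDownFrom-split f m n)

module _ {b : ℕ} {S : Pred ℤ 0ℓ} {c : ℕ → ℤ} (o : IsBOrdering b S c) where
  open IsBOrdering o

  α-minimal : ∀ i {x} → S x → α b c i ≤∞ sumOrd b c i x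
  α-minimal zero    _  = fin≤fin z≤n
  α-minimal (suc i) Sx = minimal (suc i) (s≤s z≤n) _ Sx

  α-monotone : ∀ k → α b c k ≤∞ α b c (suc k)
  α-monotone k = ≤∞-trans (α-minimal k (inS (suc k))) (x≤∞x+∞y _ _)

module _ {b : ℕ} (2≤b : 2 ≤ b) where

  maxPowDiv-∣ : ∀ n k → b ^ maxPowDiv b n k ℕ.∣ n
  maxPowDiv-∣ n zero = ℕ.1∣ n
  maxPowDiv-∣ n (suc k) with b ^ suc k ∣? n
  ... | yes b^[1+k]∣n = b^[1+k]∣n
  ... | no  _         = maxPowDiv-∣ n k

  maxPowDiv-maximal : ∀ n k {e} → e ≤ k → b ^ e ℕ.∣ n → e ≤ maxPowDiv b n k
  maxPowDiv-maximal n zero    z≤n   _     = z≤n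
  maxPowDiv-maximal n (suc k) e≤1+k b^e∣n with b ^ suc k ∣? n
  ... | yes _ = e≤1+k
  ... | no b^[1+k]∤n with ℕ.m≤n⇒m<n∨m≡n e≤1+k
  ...   | inj₁ (s≤s e≤k) = maxPowDiv-maximal n k e≤k b^e∣n
  ...   | inj₂ refl      = ⊥-elim (b^[1+k]∤n b^e∣n)

  ord-abs : ∀ a → ord b a ≡ ord b (+ ∣ a ∣)
  ord-abs a with ∣ a ∣
  ... | zero  = refl
  ... | suc _ = refl

  ord-sym : ∀ x y → ord b (x - y) ≡ ord b (y - x)
  ord-sym x y = begin
    ord b (x - y)       ≡⟨ ord-abs (x - y) ⟩
    ord b (+ ∣ x - y ∣) ≡⟨ cong (ord b ∘ +_) (ℤ.∣i-j∣≡∣j-i∣ x y) ⟩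
    ord b (+ ∣ y - x ∣) ≡⟨ ord-abs (y - x) ⟨
    ord b (y - x)       ∎
    where open ≡-Reasoning

  ≤ord-sym : ∀ {v} x y → v ≤∞ ord b (x - y) → v ≤∞ ord b (y - x)
  ≤ord-sym x y = subst (_ ≤∞_) (ord-sym x y)

  ord-self : ∀ x → ord b (x - x) ≡ ∞
  ord-self x = cong (ord b) (ℤ.+-inverseʳ x)

  fin≤ord[+n]⇒∣ : ∀ {e} n → fin e ≤∞ ord b (+ n) → b ^ e ℕ.∣ n
  fin≤ord[+n]⇒∣ {e} zero _            = (b ^ e) ℕ.∣0
  fin≤ord[+n]⇒∣ (suc m) (fin≤fin e≤r) = ℕ.∣-trans (^-monoʳ-∣ b e≤r) (maxPowDiv-∣ (suc m) (suc m))

  ∣⇒fin≤ord[+n] : ∀ {e} n → b ^ e ℕ.∣ n → fin e ≤∞ ord b (+ n)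
  ∣⇒fin≤ord[+n] zero          _     = _ ≤∞∞
  ∣⇒fin≤ord[+n] {e} n@(suc m) b^e∣n =
    fin≤fin (maxPowDiv-maximal n n (ℕ.<⇒≤ (ℕ.<-≤-trans (n<b^n 2≤b e) (ℕ.∣⇒≤ b^e∣n))) b^e∣n)

  fin≤ord⇒∣ : ∀ {e} a → fin e ≤∞ ord b a → + (b ^ e) ℤ.∣ a
  fin≤ord⇒∣ a e≤ord = ∣ᵤ⇒∣ (fin≤ord[+n]⇒∣ ∣ a ∣ (subst (fin _ ≤∞_) (ord-abs a) e≤ord))

  ∣⇒fin≤ord : ∀ {e} a → + (b ^ e) ℤ.∣ a → fin e ≤∞ ord b a
  ∣⇒fin≤ord a b^e∣a = subst (fin _ ≤∞_) (sym (ord-abs a)) (∣⇒fin≤ord[+n] ∣ a ∣ (∣⇒∣ᵤ b^e∣a))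

  ord-ultrametric : ∀ {v} x y z → v ≤∞ ord b (x - y) → v ≤∞ ord b (y - z) → v ≤∞ ord b (x - z)
  ord-ultrametric x y z v≤xy v≤yz = fin-bounds⇒≤∞ λ e e≤v →
    ∣⇒fin≤ord (x - z) (subst (+ (b ^ e) ℤ.∣_) (ℤ.+-minus-telescope x y z)
      (∣m∣n⇒∣m+n (fin≤ord⇒∣ (x - y) (≤∞-trans e≤v v≤xy)) (fin≤ord⇒∣ (y - z) (≤∞-trans e≤v v≤yz))))

  ordSum : ℤ → List ℤ → ℕ∞
  ordSum y []       = fin 0
  ordSum y (x ∷ xs) = ordSum y xs +∞ ord b (y - x)

  sumOrd≡ordSum : ∀ a n y → sumOrd b a n y ≡ ordSum y (applyDownFrom a n)
  sumOrd≡ordSum a zero    y = refl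
  sumOrd≡ordSum a (suc n) y = cong (_+∞ ord b (y - a n)) (sumOrd≡ordSum a n y)

  ordSum-++ : ∀ y xs zs → ordSum y (xs ++ zs) ≡ ordSum y zs +∞ ordSum y xs
  ordSum-++ y []       zs = sym (+∞-identityʳ _)
  ordSum-++ y (x ∷ xs) zs = ≡.trans (cong (_+∞ ord b (y - x)) (ordSum-++ y xs zs)) (+∞-assoc _ _ _)

  ordSum-↭ : ∀ y {xs zs} → xs ↭ zs → ordSum y xs ≡ ordSum y zs
  ordSum-↭ y refl        = refl
  ordSum-↭ y (prep x p)  = cong (_+∞ ord b (y - x)) (ordSum-↭ y p)
  ordSum-↭ y (swap x z p) =
    ≡.trans (cong (λ s → (s +∞ ord b (y - z)) +∞ ord b (y - x)) (ordSum-↭ y p)) (xy+z≡xz+y _ _ _)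
  ordSum-↭ y (trans p q) = ≡.trans (ordSum-↭ y p) (ordSum-↭ y q)

  closest : ∀ x y ys → ∃₂ λ y* ys′ →
    y* ∷ ys′ ↭ y ∷ ys × All (λ z → ord b (z - x) ≤∞ ord b (y* - x)) ys′
  closest x y [] = y , [] , ↭-refl , []
  closest x y (z ∷ zs) with closest x z zs
  ... | z* , zs′ , p , z*-closest with ≤∞-total (ord b (y - x)) (ord b (z* - x))
  ...   | inj₁ y≤z* = z* , y ∷ zs′ , ↭-trans (↭-swap z* y ↭-refl) (↭-prep y p) , y≤z* ∷ z*-closest
  ...   | inj₂ z*≤y = y , z ∷ zs , ↭-refl ,
                      All-resp-↭ p (z*≤y ∷ All.map (λ w≤z* → ≤∞-trans w≤z* z*≤y) z*-closest)

  -- Each x is matched with its closest y; by the ultrametric inequality the y left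
  -- over is no closer to x than to x's partner.
  matching : ∀ xs ys → length ys ≡ suc (length xs) →
    ∃₂ λ y rest → y ∷ rest ↭ ys × ordSum y xs ≤∞ ordSum y rest
  matching []       (y ∷ [])    _  = y , [] , ↭-refl , ≤∞-refl
  matching (x ∷ xs) (y ∷ ys)    eq with closest x y ys
  ... | y* , ys′ , p , y*-closest with matching xs ys′ (ℕ.suc-injective (≡.trans (↭-length p) eq))
  ...   | z , rest , q , le = z , y* ∷ rest , perm , +∞-mono-≤∞ le zx≤zy*
    where
    perm : z ∷ y* ∷ rest ↭ y ∷ ys
    perm = ↭-trans (↭-swap z y* ↭-refl) (↭-trans (↭-prep y* q) p)
    zx≤xy* : ord b (z - x) ≤∞ ord b (x - y*)
    zx≤xy* = ≤ord-sym y* x (All.lookup y*-closest (∈-resp-↭ q (here refl)))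
    zx≤zy* : ord b (z - x) ≤∞ ord b (z - y*)
    zx≤zy* = ord-ultrametric z x y* ≤∞-refl zx≤xy*
  matching []       []          ()
  matching []       (_ ∷ _ ∷ _) ()
  matching (_ ∷ _)  []          ()

  module _ {S : Pred ℤ 0ℓ} {c : ℕ → ℤ} (o : IsBOrdering b S c) where
    open IsBOrdering o

    -- Σ_{m<j≤n+m} ord (a_m - a_j), indexed by j + m so that suc p + m reduces to suc (p + m).
    tailSum : ℕ → ℕ → ℕ∞
    tailSum m n = sumOrd b (λ j → c (suc (j + m))) n (c m)

    module _ (m : ℕ) {y : ℤ} (Sy : S y) where

      α+tailSum+ord≤sumOrd-closer : ∀ p → α b c m +∞ tailSum m p ≤∞ α b c (p + m) →
        ord b (c m - y) ≤∞ ord b (c m - c (p + m)) →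
        (α b c m +∞ tailSum m p) +∞ ord b (c m - y) ≤∞ sumOrd b c (suc (p + m)) y
      α+tailSum+ord≤sumOrd-closer p α+tail≤α closer =
        +∞-mono-≤∞ (≤∞-trans α+tail≤α (α-minimal o (p + m) Sy))
                   (ord-ultrametric y (c m) (c (p + m)) (≤ord-sym (c m) y ≤∞-refl) closer)

      -- Scan j = p + m downwards to the last a_j at least as close to a_m as y is.
      -- Above it, ord (a_m - a_j) ≤ ord (y - a_j) term by term; at it, the
      -- remaining tail is bounded through α_j ≤ sumOrd j y.
      α+tailSum+ord≤sumOrd : ∀ p → (∀ {q} → q ≤ p → α b c m +∞ tailSum m q ≤∞ α b c (q + m)) →
        (α b c m +∞ tailSum m p) +∞ ord b (c m - y) ≤∞ sumOrd b c (suc (p + m)) y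
      α+tailSum+ord≤sumOrd zero α+tail≤α = α+tailSum+ord≤sumOrd-closer zero (α+tail≤α z≤n)
        (subst (ord b (c m - y) ≤∞_) (sym (ord-self (c m))) (ord b (c m - y) ≤∞∞))
      α+tailSum+ord≤sumOrd (suc p) α+tail≤α
        with ≤∞-total (ord b (c m - c (suc (p + m)))) (ord b (c m - y))
      ... | inj₂ closer  = α+tailSum+ord≤sumOrd-closer (suc p) (α+tail≤α ℕ.≤-refl) closer
      ... | inj₁ farther = begin
        (α b c m +∞ (tailSum m p +∞ t)) +∞ d ≡⟨ cong (_+∞ d) (+∞-assoc _ _ _) ⟨
        ((α b c m +∞ tailSum m p) +∞ t) +∞ d ≡⟨ xy+z≡xz+y _ _ _ ⟩
        ((α b c m +∞ tailSum m p) +∞ d) +∞ t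
          ≲⟨ +∞-mono-≤∞ (α+tailSum+ord≤sumOrd p (λ q≤p → α+tail≤α (ℕ.m≤n⇒m≤1+n q≤p))) t≤ord[y-cj] ⟩
        sumOrd b c (suc (p + m)) y +∞ ord b (y - c j) ∎
        where
        open ≤∞-Reasoning
        j = suc (p + m)
        d = ord b (c m - y)
        t = ord b (c m - c j)
        t≤ord[y-cj] : t ≤∞ ord b (y - c j)
        t≤ord[y-cj] = ord-ultrametric y (c m) (c j) (≤ord-sym (c m) y farther) ≤∞-refl

    α+tailSum≤α : ∀ m n → α b c m +∞ tailSum m n ≤∞ α b c (n + m)
    α+tailSum≤α m = <-rec (λ n → α b c m +∞ tailSum m n ≤∞ α b c (n + m)) step
      where
      step : ∀ n → (∀ {q} → q < n → α b c m +∞ tailSum m q ≤∞ α b c (q + m)) →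
             α b c m +∞ tailSum m n ≤∞ α b c (n + m)
      step zero    _  = subst (_≤∞ α b c m) (sym (+∞-identityʳ _)) ≤∞-refl
      step (suc p) ih = subst (_≤∞ α b c (suc p + m)) (+∞-assoc _ _ _)
        (α+tailSum+ord≤sumOrd m (inS (suc (p + m))) p (λ q≤p → ih (s≤s q≤p)))

    ordSum-others≤α : ∀ m n {rest} → c m ∷ rest ↭ applyDownFrom c (suc (n + m)) →
      ordSum (c m) rest ≤∞ α b c (n + m)
    ordSum-others≤α m n {rest} cm∷rest↭ = begin
      ordSum (c m) rest                                     ≡⟨ ordSum-↭ (c m) rest↭ ⟩
      ordSum (c m) (before ++ applyDownFrom c m)           ≡⟨ ordSum-++ (c m) before _ ⟩
      ordSum (c m) (applyDownFrom c m) +∞ ordSum (c m) before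
        ≡⟨ cong₂ _+∞_ (sumOrd≡ordSum c m (c m)) (sumOrd≡ordSum _ n (c m)) ⟨
      α b c m +∞ tailSum m n                                 ≲⟨ α+tailSum≤α m n ⟩
      α b c (n + m)                                          ∎
      where
      open ≤∞-Reasoning
      before = applyDownFrom (λ j → c (suc (j + m))) n
      rest↭ : rest ↭ before ++ applyDownFrom c m
      rest↭ = drop-∷ (↭-trans cm∷rest↭ (↭-trans (↭-reflexive (applyDownFrom-split c m n))
                                                 (shift (c m) before (applyDownFrom c m))))

    ∃-ordSum≤α : ∀ K xs → length xs ≡ K → ∃ λ m → ordSum (c m) xs ≤∞ α b c K
    ∃-ordSum≤α K xs |xs|≡K
      with matching xs (applyDownFrom c (suc K))
                    (≡.trans (length-applyDownFrom c (suc K)) (cong suc (sym |xs|≡K)))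
    ... | y , rest , y∷rest↭ , le with ∈-applyDownFrom⁻ c (∈-resp-↭ y∷rest↭ (here refl))
    ... | m , s≤s m≤K , refl =
      m , ≤∞-trans le (subst P (ℕ.m∸n+n≡m m≤K) (ordSum-others≤α m (K ∸ m)) y∷rest↭)
      where
      P : ℕ → Set
      P K = c m ∷ rest ↭ applyDownFrom c (suc K) → ordSum (c m) rest ≤∞ α b c K

    α-superadditive : ∀ k l → α b c k +∞ α b c l ≤∞ α b c (k + l)
    α-superadditive k l = let m , le = ∃-ordSum≤α (k + l) (xs ++ ys) |xs++ys|≡k+l in begin
      α b c k +∞ α b c l
        ≲⟨ +∞-mono-≤∞ (α-minimal o k (inS m)) (α-minimal o l (inS m)) ⟩
      sumOrd b c k (c m) +∞ sumOrd b c l (c m)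
        ≡⟨ cong₂ _+∞_ (sumOrd≡ordSum c k (c m)) (sumOrd≡ordSum c l (c m)) ⟩
      ordSum (c m) xs +∞ ordSum (c m) ys        ≡⟨ +∞-comm _ _ ⟩
      ordSum (c m) ys +∞ ordSum (c m) xs        ≡⟨ ordSum-++ (c m) xs ys ⟨
      ordSum (c m) (xs ++ ys)                   ≲⟨ le ⟩
      α b c (k + l)                             ∎
      where
      open ≤∞-Reasoning
      xs = applyDownFrom c k
      ys = applyDownFrom c l
      |xs++ys|≡k+l : length (xs ++ ys) ≡ k + l
      |xs++ys|≡k+l =
        ≡.trans (length-++ xs) (cong₂ _+_ (length-applyDownFrom c k) (length-applyDownFrom c l))

  α-antitone : ∀ {S₁ S₂ : Pred ℤ 0ℓ} {c₁ c₂} → S₁ ⊆ S₂ →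
    IsBOrdering b S₁ c₁ → IsBOrdering b S₂ c₂ → ∀ k → α b c₂ k ≤∞ α b c₁ k
  α-antitone {c₁ = c₁} {c₂} S₁⊆S₂ o₁ o₂ k =
    let m , le = ∃-ordSum≤α o₁ k (applyDownFrom c₂ k) (length-applyDownFrom c₂ k) in begin
    α b c₂ k                           ≲⟨ α-minimal o₂ k (S₁⊆S₂ (IsBOrdering.inS o₁ m)) ⟩
    sumOrd b c₂ k (c₁ m)               ≡⟨ sumOrd≡ordSum c₂ k (c₁ m) ⟩
    ordSum (c₁ m) (applyDownFrom c₂ k) ≲⟨ le ⟩
    α b c₁ k                           ∎
    where open ≤∞-Reasoning

proposition5p4 : (b : ℕ) → 2 ≤ b →
    ((S : Pred ℤ 0ℓ) → ∃ S → (a : ℕ → ℤ) → IsBOrdering b S a →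
       ∀ k → α b a k ≤∞ α b a (suc k))
    × ((S : Pred ℤ 0ℓ) → ∃ S → (a : ℕ → ℤ) → IsBOrdering b S a →
       ∀ k l → α b a k +∞ α b a l ≤∞ α b a (k + l))
    × ((S₁ S₂ : Pred ℤ 0ℓ) → ∃ S₁ → ∃ S₂ → S₁ ⊆ S₂ →
       (a₁ a₂ : ℕ → ℤ) → IsBOrdering b S₁ a₁ → IsBOrdering b S₂ a₂ →
       ∀ k → α b a₂ k ≤∞ α b a₁ k)
proposition5p4 b 2≤b =
    (λ _ _ _ → α-monotone)
  , (λ _ _ _ → α-superadditive 2≤b)
  , (λ _ _ _ _ S₁⊆S₂ _ _ → α-antitone 2≤b S₁⊆S₂)
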